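{- Let $m\in\mathbb{Z}\setminus\{0,-1\}$ and let the integers $c_m(n)$ be defined by $$\frac{1}{(1-x)^{m}}\prod_{i=0}^{\infty}\frac{1}{(1-x^{2^{i}})^{m}}=\sum_{n=0}^{\infty}c_{m}(n)x^{n}.$$ Let $(t_n)_{n\ge 0}$ be the Prouhet–Thue–Morse sequence defined by $\prod_{i=0}^{\infty}(1-x^{2^{i}})=\sum_{n=0}^{\infty}t_nx^n$. Then $c_m(0)=1$, and for every integer $n\ge 1$, $$\nu_{2}(c_{m}(n))=\begin{cases}\nu_{2}(m)+1, & \text{if } m\equiv 0\pmod 2,\\ 1, & \text{if } m\equiv 1\pmod 2 \text{ and } t_{n}\neq t_{n-1},\\ \nu_{2}(m+1)+1, & \text{if } m\equiv 1\pmod 2 \text{ and } t_{n}=t_{n-1}.\end{cases}$$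
   Context: For a prime $p$ and a nonzero integer $a$, $\nu_p(a)$ denotes the exponent of the highest power of $p$ dividing $a$, with $\nu_p(0)=+\infty$. Equivalently $t_n=(-1)^{s_2(n)}$ where $s_2(n)$ is the number of ones in the binary expansion of $n$. -}

module Defs where

open import Data.Nat as ℕ using (ℕ; zero; suc; _^_)
open import Data.Nat.Divisibility using (_∣?_)
open import Data.Integer using (ℤ; +_; -[1+_]; _+_; _*_; -_; _-_)
open import Data.Integer.Divisibility using (_∣_)
open import Data.Bool using (if_then_else_)
open import Data.List using (List; []; _∷_; foldr; upTo; map)
open import Relation.Nullary using (¬_)
open import Relation.Nullary.Decidable using (⌊_⌋)
open import Relation.Binary.PropositionalEquality using (_≡_)
open import Data.Product using (∃; _×_)

Series : Set
Series = ℕ → ℤ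

𝟙 : Series
𝟙 zero    = + 1
𝟙 (suc _) = + 0

sumTo : ℕ → (ℕ → ℤ) → ℤ
sumTo zero    f = f zero
sumTo (suc n) f = sumTo n f + f (suc n)

_⊛_ : Series → Series → Series
(f ⊛ g) n = sumTo n (λ k → f k * g (n ℕ.∸ k))

infixl 7 _⊛_

_^ˢ_ : Series → ℕ → Series
f ^ˢ zero  = 𝟙
f ^ˢ suc j = f ⊛ (f ^ˢ j)

-- The polynomial 1 - x^k  (used with k ≥ 1).
oneMinusX^ : ℕ → Series
oneMinusX^ k n =
  (if ⌊ n ℕ.≟ 0 ⌋ then + 1 else + 0) - (if ⌊ n ℕ.≟ k ⌋ then + 1 else + 0)

-- Its inverse (1 - x^k)^{-1} = Σ_j x^{jk}  (used with k ≥ 1).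
invOneMinusX^ : ℕ → Series
invOneMinusX^ k n = if ⌊ k ∣? n ⌋ then + 1 else + 0

oneMinusX^-pow : ℕ → ℤ → Series
oneMinusX^-pow k (+ j)     = oneMinusX^ k ^ˢ j
oneMinusX^-pow k -[1+ j ]  = invOneMinusX^ k ^ˢ suc j

partialProd : ℤ → ℕ → Series
partialProd e N = foldr (λ i acc → oneMinusX^-pow (2 ^ i) e ⊛ acc) 𝟙 (upTo N)

-- c is the coefficient sequence of the (x-adically convergent) infinite
-- product  (1 - x)^a · Π_{i ≥ 0} (1 - x^{2^i})^e : each coefficient of the
-- partial products eventually stabilises at the value c n.
IsCoeffsOf : ℤ → ℤ → Series → Set
IsCoeffsOf a e c =
  ∀ n → ∃ λ N → ∀ N′ → N ℕ.≤ N′ →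
    (oneMinusX^-pow 1 a ⊛ partialProd e N′) n ≡ c n

-- 2-adic valuation as a relation: ν₂(a) = k  (for a ≠ 0).
ν₂≡ : ℤ → ℕ → Set
ν₂≡ a k = ((+ (2 ^ k)) ∣ a) × ¬ ((+ (2 ^ suc k)) ∣ a)

{-# OPTIONS --safe #-}
-- Below x^(2^N) the product is U^(-m), where U = (1 - x) Π_{i<N} (1 - x^(2^i)) has
-- coefficients u₀ = 1 and uₙ = tₙ - tₙ₋₁ ∈ {0, ±2}.  Expanding the Cauchy square and pairing its
-- off-diagonal terms shows that every positive coefficient of U² is ≡ 4 (mod 8).  Call a series
-- "near one at level K" when it is ≡ 1 (mod 2^K) and all its positive coefficients have valuation
-- exactly K.  The binomial congruence X^a ≡ 1 + a (X - 1) (mod 2^(2K)) shows that squaring raises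
-- the level by one (K ≥ 2), while odd powers and inversion preserve it (K ≥ 1).  Hence U^e is near
-- one at level ν₂(e) + 1 for every even e ≠ 0, which settles even m.  For odd m, U^(-m) = U · W
-- with W = U^(-(m+1)), and its coefficient of index n is uₙ + wₙ modulo a higher power of 2: it has
-- valuation 1 when tₙ ≠ tₙ₋₁, and valuation ν₂(m+1) + 1 when uₙ = 0.
module Submission where

open import Defs
open import Algebra.Bundles using (CommutativeMonoid)
open import Algebra.Structures using (IsCommutativeMonoid)
import Algebra.Properties.CommutativeMonoid.Mult as MultProperties
import Algebra.Properties.CommutativeSemigroup as CommSemigroupProperties
open import Data.Bool using (if_then_else_)
open import Data.Integer as ℤ using (ℤ; +_; -[1+_]; _+_; _*_; -_; _-_)
import Data.Integer.Properties as ℤP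
import Data.Integer.Divisibility.Signed as Signed
open Signed using (divides) renaming (_∣_ to _∣ˢ_)
open import Data.Integer.Tactic.RingSolver using (solve-∀)
open import Data.Integer.Divisibility using (_∣_)
import Data.Integer.DivMod as ℤDivMod
open import Data.List using (List; []; _∷_; foldr; applyUpTo; upTo)
open import Data.Nat as ℕ using (ℕ; zero; suc; z≤n; s≤s)
import Data.Nat.Properties as ℕP
open import Data.Product using (∃; _×_; _,_; proj₁; proj₂)
open import Data.Sum using (_⊎_; inj₁; inj₂)
import Data.Nat.Divisibility as ℕD
import Data.Nat.Tactic.RingSolver as ℕSolver
open import Function using (_∘_; id)
open import Level using (0ℓ)
open import Relation.Binary.Bundles using (Setoid)
open import Relation.Binary.PropositionalEquality
open import Relation.Nullary using (¬_; yes; no; contradiction)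
open import Relation.Nullary.Decidable using (⌊_⌋)

-- Finite sums

sumTo-cong : ∀ n {f g : ℕ → ℤ} → (∀ {k} → k ℕ.≤ n → f k ≡ g k) → sumTo n f ≡ sumTo n g
sumTo-cong zero    f≡g = f≡g z≤n
sumTo-cong (suc n) f≡g = cong₂ _+_ (sumTo-cong n (f≡g ∘ ℕP.m≤n⇒m≤1+n)) (f≡g ℕP.≤-refl)

sumTo-zero : ∀ n {f : ℕ → ℤ} → (∀ {k} → k ℕ.≤ n → f k ≡ + 0) → sumTo n f ≡ + 0
sumTo-zero zero    f≡0 = f≡0 z≤n
sumTo-zero (suc n) f≡0 = cong₂ _+_ (sumTo-zero n (f≡0 ∘ ℕP.m≤n⇒m≤1+n)) (f≡0 ℕP.≤-refl)

sumTo-+ : ∀ n (f g : ℕ → ℤ) → sumTo n (λ k → f k + g k) ≡ sumTo n f + sumTo n g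
sumTo-+ zero    f g = refl
sumTo-+ (suc n) f g rewrite sumTo-+ n f g =
  CommSemigroupProperties.interchange ℤP.+-commutativeSemigroup (sumTo n f) (sumTo n g) (f (suc n)) (g (suc n))

sumTo-neg : ∀ n (f : ℕ → ℤ) → sumTo n (λ k → - f k) ≡ - sumTo n f
sumTo-neg zero    f = refl
sumTo-neg (suc n) f rewrite sumTo-neg n f = sym (ℤP.neg-distrib-+ (sumTo n f) (f (suc n)))

sumTo-- : ∀ n (f g : ℕ → ℤ) → sumTo n (λ k → f k - g k) ≡ sumTo n f - sumTo n g
sumTo-- n f g = trans (sumTo-+ n f (λ k → - g k)) (cong (λ s → sumTo n f + s) (sumTo-neg n g))

sumTo-*ˡ : ∀ n a (f : ℕ → ℤ) → sumTo n (λ k → a * f k) ≡ a * sumTo n f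
sumTo-*ˡ zero    a f = refl
sumTo-*ˡ (suc n) a f rewrite sumTo-*ˡ n a f = sym (ℤP.*-distribˡ-+ a (sumTo n f) (f (suc n)))

sumTo-*ʳ : ∀ n a (f : ℕ → ℤ) → sumTo n (λ k → f k * a) ≡ sumTo n f * a
sumTo-*ʳ zero    a f = refl
sumTo-*ʳ (suc n) a f rewrite sumTo-*ʳ n a f = sym (ℤP.*-distribʳ-+ a (sumTo n f) (f (suc n)))

sumTo-suc : ∀ n (f : ℕ → ℤ) → sumTo (suc n) f ≡ f 0 + sumTo n (f ∘ suc)
sumTo-suc zero    f = refl
sumTo-suc (suc n) f rewrite sumTo-suc n f = ℤP.+-assoc (f 0) _ _

sumTo-reverse : ∀ n (f : ℕ → ℤ) → sumTo n f ≡ sumTo n (λ k → f (n ℕ.∸ k))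
sumTo-reverse zero    f = refl
sumTo-reverse (suc n) f = begin
  sumTo n f + f (suc n)                      ≡⟨ cong (_+ f (suc n)) (sumTo-reverse n f) ⟩
  sumTo n (λ k → f (n ℕ.∸ k)) + f (suc n)    ≡⟨ ℤP.+-comm _ (f (suc n)) ⟩
  f (suc n) + sumTo n (λ k → f (n ℕ.∸ k))    ≡⟨ sumTo-suc n (λ k → f (suc n ℕ.∸ k)) ⟨
  sumTo (suc n) (λ k → f (suc n ℕ.∸ k))      ∎
  where open ≡-Reasoning

sumTo-triangle : ∀ n (F : ℕ → ℕ → ℤ) →
  sumTo n (λ k → sumTo k (λ i → F i k)) ≡ sumTo n (λ i → sumTo (n ℕ.∸ i) (λ j → F i (i ℕ.+ j)))
sumTo-triangle zero    F = refl
sumTo-triangle (suc n) F = begin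
  sumTo n (λ k → sumTo k (λ i → F i k)) + (column + corner)
    ≡⟨ cong (_+ (column + corner)) (sumTo-triangle n F) ⟩
  rows n + (column + corner)
    ≡⟨ ℤP.+-assoc (rows n) column corner ⟨
  rows n + column + corner
    ≡⟨ cong₂ _+_ (sumTo-+ n _ _) (cong (F (suc n)) (ℕP.+-identityʳ (suc n))) ⟨
  sumTo n (λ i → row i (n ℕ.∸ i) + F i (suc n)) + row (suc n) 0
    ≡⟨ cong₂ _+_ (sumTo-cong n extend-row) (cong (row (suc n)) (ℕP.n∸n≡0 n)) ⟨
  rows (suc n) + row (suc n) (n ℕ.∸ n) ∎
  where
  open ≡-Reasoning
  row : ℕ → ℕ → ℤ
  row i r = sumTo r (λ j → F i (i ℕ.+ j))
  rows : ℕ → ℤ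
  rows m = sumTo n (λ i → row i (m ℕ.∸ i))
  column corner : ℤ
  column = sumTo n (λ i → F i (suc n))
  corner = F (suc n) (suc n)
  extend-row : ∀ {i} → i ℕ.≤ n → row i (suc n ℕ.∸ i) ≡ row i (n ℕ.∸ i) + F i (suc n)
  extend-row {i} i≤n rewrite ℕP.+-∸-assoc 1 i≤n =
    cong (λ m → row i (n ℕ.∸ i) + F i m) (trans (ℕP.+-suc i (n ℕ.∸ i)) (cong suc (ℕP.m+[n∸m]≡n i≤n)))

indicator : ℕ → ℕ → ℤ
indicator p i = if ⌊ i ℕ.≟ p ⌋ then + 1 else + 0

indicator-≡ : ∀ {p i} → i ≡ p → indicator p i ≡ + 1
indicator-≡ {p} {i} i≡p with i ℕ.≟ p
... | yes _   = refl
... | no i≢p = contradiction i≡p i≢p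

indicator-≢ : ∀ {p i} → i ≢ p → indicator p i ≡ + 0
indicator-≢ {p} {i} i≢p with i ℕ.≟ p
... | yes i≡p = contradiction i≡p i≢p
... | no _    = refl

sumTo-indicator-> : ∀ n {p} (g : ℕ → ℤ) → n ℕ.< p → sumTo n (λ i → indicator p i * g i) ≡ + 0
sumTo-indicator-> n g n<p = sumTo-zero n λ {k} k≤n →
  trans (cong (_* g k) (indicator-≢ (ℕP.<⇒≢ (ℕP.≤-<-trans k≤n n<p)))) (ℤP.*-zeroˡ (g k))

sumTo-indicator-≤ : ∀ n {p} (g : ℕ → ℤ) → p ℕ.≤ n → sumTo n (λ i → indicator p i * g i) ≡ g p
sumTo-indicator-≤ zero    g z≤n = ℤP.*-identityˡ (g 0)
sumTo-indicator-≤ (suc n) {p} g p≤1+n with ℕP.m≤n⇒m<n∨m≡n p≤1+n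
... | inj₁ p<1+n = begin
  sumTo n (λ i → indicator p i * g i) + indicator p (suc n) * g (suc n)
    ≡⟨ cong₂ _+_ (sumTo-indicator-≤ n g (ℕP.≤-pred p<1+n)) (cong (_* g (suc n)) (indicator-≢ (ℕP.>⇒≢ p<1+n))) ⟩
  g p + + 0 * g (suc n)
    ≡⟨ ℤP.+-identityʳ (g p) ⟩
  g p ∎
  where open ≡-Reasoning
... | inj₂ refl = begin
  sumTo n (λ i → indicator p i * g i) + indicator p p * g p
    ≡⟨ cong₂ _+_ (sumTo-indicator-> n {suc n} g (ℕP.n<1+n n)) (cong (_* g p) (indicator-≡ {p} refl)) ⟩
  + 0 + + 1 * g p
    ≡⟨ trans (ℤP.+-identityˡ (+ 1 * g p)) (ℤP.*-identityˡ (g p)) ⟩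
  g p ∎
  where open ≡-Reasoning

-- Formal power series

infixl 6 _+ˢ_ _-ˢ_
infixl 7 _·ˢ_

_+ˢ_ _-ˢ_ : Series → Series → Series
(f +ˢ g) n = f n + g n
(f -ˢ g) n = f n - g n

_·ˢ_ : ℤ → Series → Series
(a ·ˢ f) n = a * f n

⊛-cong : ∀ {f f′ g g′} → f ≗ f′ → g ≗ g′ → f ⊛ g ≗ f′ ⊛ g′
⊛-cong f≗f′ g≗g′ n = sumTo-cong n (λ {k} _ → cong₂ _*_ (f≗f′ k) (g≗g′ (n ℕ.∸ k)))

⊛-congˡ : ∀ f {g g′} → g ≗ g′ → f ⊛ g ≗ f ⊛ g′
⊛-congˡ f = ⊛-cong {f} (λ _ → refl)

⊛-congʳ : ∀ g {f f′} → f ≗ f′ → f ⊛ g ≗ f′ ⊛ g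
⊛-congʳ g f≗f′ = ⊛-cong {g = g} f≗f′ (λ _ → refl)

⊛-comm : ∀ f g → f ⊛ g ≗ g ⊛ f
⊛-comm f g n = trans (sumTo-reverse n _) (sumTo-cong n λ {k} k≤n →
  trans (cong (λ i → f (n ℕ.∸ k) * g i) (ℕP.m∸[m∸n]≡n k≤n)) (ℤP.*-comm (f (n ℕ.∸ k)) (g k)))

⊛-identityˡ : ∀ f → 𝟙 ⊛ f ≗ f
⊛-identityˡ f zero    = ℤP.*-identityˡ (f 0)
⊛-identityˡ f (suc n) = begin
  (𝟙 ⊛ f) (suc n)
    ≡⟨ sumTo-suc n _ ⟩
  + 1 * f (suc n) + sumTo n (λ k → + 0 * f (n ℕ.∸ k))
    ≡⟨ cong₂ _+_ (ℤP.*-identityˡ (f (suc n))) (sumTo-zero n (λ _ → refl)) ⟩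
  f (suc n) + + 0
    ≡⟨ ℤP.+-identityʳ (f (suc n)) ⟩
  f (suc n) ∎
  where open ≡-Reasoning

⊛-identityʳ : ∀ f → f ⊛ 𝟙 ≗ f
⊛-identityʳ f n = trans (⊛-comm f 𝟙 n) (⊛-identityˡ f n)

⊛-assoc : ∀ f g h → (f ⊛ g) ⊛ h ≗ f ⊛ (g ⊛ h)
⊛-assoc f g h n = begin
  sumTo n (λ k → sumTo k (λ i → f i * g (k ℕ.∸ i)) * h (n ℕ.∸ k))
    ≡⟨ sumTo-cong n (λ {k} _ → sym (sumTo-*ʳ k (h (n ℕ.∸ k)) _)) ⟩
  sumTo n (λ k → sumTo k (λ i → F i k))
    ≡⟨ sumTo-triangle n F ⟩
  sumTo n (λ i → sumTo (n ℕ.∸ i) (λ j → F i (i ℕ.+ j)))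
    ≡⟨ sumTo-cong n (λ {i} _ →
         trans (sumTo-cong (n ℕ.∸ i) (λ {j} _ → reassociate i j)) (sumTo-*ˡ (n ℕ.∸ i) (f i) _)) ⟩
  sumTo n (λ i → f i * sumTo (n ℕ.∸ i) (λ j → g j * h (n ℕ.∸ i ℕ.∸ j))) ∎
  where
  open ≡-Reasoning
  F : ℕ → ℕ → ℤ
  F i k = f i * g (k ℕ.∸ i) * h (n ℕ.∸ k)
  reassociate : ∀ i j → F i (i ℕ.+ j) ≡ f i * (g j * h (n ℕ.∸ i ℕ.∸ j))
  reassociate i j rewrite ℕP.m+n∸m≡n i j | ℕP.∸-+-assoc n i j = ℤP.*-assoc (f i) (g j) (h (n ℕ.∸ (i ℕ.+ j)))

⊛-distribʳ-- : ∀ f g h → (f -ˢ g) ⊛ h ≗ f ⊛ h -ˢ g ⊛ h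
⊛-distribʳ-- f g h n = trans (sumTo-cong n (λ {k} _ → *-distribʳ-- (f k) (g k) (h (n ℕ.∸ k)))) (sumTo-- n _ _)
  where
  *-distribʳ-- : ∀ a b c → (a - b) * c ≡ a * c - b * c
  *-distribʳ-- = solve-∀

⊛-distribˡ-- : ∀ f g h → f ⊛ (g -ˢ h) ≗ f ⊛ g -ˢ f ⊛ h
⊛-distribˡ-- f g h n = begin
  (f ⊛ (g -ˢ h)) n     ≡⟨ ⊛-comm f (g -ˢ h) n ⟩
  ((g -ˢ h) ⊛ f) n     ≡⟨ ⊛-distribʳ-- g h f n ⟩
  (g ⊛ f -ˢ h ⊛ f) n   ≡⟨ cong₂ _-_ (⊛-comm g f n) (⊛-comm h f n) ⟩
  (f ⊛ g -ˢ f ⊛ h) n   ∎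
  where open ≡-Reasoning

⊛-expand : ∀ X Y → X ⊛ Y ≗ X +ˢ Y -ˢ 𝟙 +ˢ (X -ˢ 𝟙) ⊛ (Y -ˢ 𝟙)
⊛-expand X Y n = begin
  (X ⊛ Y) n
    ≡⟨ regroup ((X ⊛ Y) n) (X n) (Y n) (𝟙 n) ⟩
  X n + Y n - 𝟙 n + ((X ⊛ Y) n - X n - (Y n - 𝟙 n))
    ≡⟨ cong (_+_ linear) (cong₂ (λ a b → (X ⊛ Y) n - a - b) (⊛-identityʳ X n) (⊛-identityˡ (Y -ˢ 𝟙) n)) ⟨
  X n + Y n - 𝟙 n + ((X ⊛ Y) n - (X ⊛ 𝟙) n - (𝟙 ⊛ (Y -ˢ 𝟙)) n)
    ≡⟨ cong (_+_ linear) (cong (_- (𝟙 ⊛ (Y -ˢ 𝟙)) n) (⊛-distribˡ-- X Y 𝟙 n)) ⟨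
  X n + Y n - 𝟙 n + ((X ⊛ (Y -ˢ 𝟙)) n - (𝟙 ⊛ (Y -ˢ 𝟙)) n)
    ≡⟨ cong (_+_ linear) (⊛-distribʳ-- X 𝟙 (Y -ˢ 𝟙) n) ⟨
  (X +ˢ Y -ˢ 𝟙 +ˢ (X -ˢ 𝟙) ⊛ (Y -ˢ 𝟙)) n ∎
  where
  open ≡-Reasoning
  linear : ℤ
  linear = X n + Y n - 𝟙 n
  regroup : ∀ p x y o → p ≡ x + y - o + (p - x - (y - o))
  regroup = solve-∀

⊛-isCommutativeMonoid : IsCommutativeMonoid _≗_ _⊛_ 𝟙
⊛-isCommutativeMonoid = record
  { isMonoid = record
    { isSemigroup = record
      { isMagma = record { isEquivalence = Setoid.isEquivalence (ℕ →-setoid ℤ) ; ∙-cong = ⊛-cong }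
      ; assoc = ⊛-assoc }
    ; identity = ⊛-identityˡ , ⊛-identityʳ }
  ; comm = ⊛-comm }

⊛-commutativeMonoid : CommutativeMonoid 0ℓ 0ℓ
⊛-commutativeMonoid = record { isCommutativeMonoid = ⊛-isCommutativeMonoid }

open MultProperties ⊛-commutativeMonoid using (×-congʳ; ×-assocˡ; ×-distrib-+)
  renaming (_×_ to _×ˢ_)

^ˢ≡× : ∀ f n → f ^ˢ n ≡ n ×ˢ f
^ˢ≡× f zero    = refl
^ˢ≡× f (suc n) = cong (f ⊛_) (^ˢ≡× f n)

^ˢ-cong : ∀ {f g} n → f ≗ g → f ^ˢ n ≗ g ^ˢ n
^ˢ-cong {f} {g} n f≗g rewrite ^ˢ≡× f n | ^ˢ≡× g n = ×-congʳ n f≗g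

^ˢ-assoc : ∀ f m n → (f ^ˢ m) ^ˢ n ≗ f ^ˢ (n ℕ.* m)
^ˢ-assoc f m n rewrite ^ˢ≡× f m | ^ˢ≡× (m ×ˢ f) n | ^ˢ≡× f (n ℕ.* m) = ×-assocˡ f n m

^ˢ-distrib-⊛ : ∀ f g n → (f ⊛ g) ^ˢ n ≗ f ^ˢ n ⊛ g ^ˢ n
^ˢ-distrib-⊛ f g n rewrite ^ˢ≡× (f ⊛ g) n | ^ˢ≡× f n | ^ˢ≡× g n = ×-distrib-+ f g n

𝟙-^ˢ : ∀ n → 𝟙 ^ˢ n ≗ 𝟙
𝟙-^ˢ zero    = λ _ → refl
𝟙-^ˢ (suc n) k = trans (⊛-identityˡ (𝟙 ^ˢ n) k) (𝟙-^ˢ n k)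

⊛-inverse-^ˢ : ∀ {X Y} n → X ⊛ Y ≗ 𝟙 → X ^ˢ n ⊛ Y ^ˢ n ≗ 𝟙
⊛-inverse-^ˢ {X} {Y} n XY≗𝟙 k = begin
  (X ^ˢ n ⊛ Y ^ˢ n) k ≡⟨ ^ˢ-distrib-⊛ X Y n k ⟨
  ((X ⊛ Y) ^ˢ n) k    ≡⟨ ^ˢ-cong n XY≗𝟙 k ⟩
  (𝟙 ^ˢ n) k          ≡⟨ 𝟙-^ˢ n k ⟩
  𝟙 k                 ∎
  where open ≡-Reasoning

prod : (ℕ → Series) → List ℕ → Series
prod h = foldr (λ i acc → h i ⊛ acc) 𝟙

prod-cong : ∀ {h h′} l → (∀ i → h i ≗ h′ i) → prod h l ≗ prod h′ l
prod-cong []      h≗h′ = λ _ → refl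
prod-cong (i ∷ l) h≗h′ = ⊛-cong (h≗h′ i) (prod-cong l h≗h′)

prod-^ˢ : ∀ h j l → prod (λ i → h i ^ˢ j) l ≗ prod h l ^ˢ j
prod-^ˢ h j []      k = sym (𝟙-^ˢ j k)
prod-^ˢ h j (i ∷ l) k = begin
  (h i ^ˢ j ⊛ prod (λ i → h i ^ˢ j) l) k ≡⟨ ⊛-congˡ (h i ^ˢ j) (prod-^ˢ h j l) k ⟩
  (h i ^ˢ j ⊛ prod h l ^ˢ j) k           ≡⟨ ^ˢ-distrib-⊛ (h i) (prod h l) j k ⟨
  ((h i ⊛ prod h l) ^ˢ j) k              ∎
  where open ≡-Reasoning

prod-applyUpTo-suc : ∀ h f N → prod h (applyUpTo f (suc N)) ≗ h (f N) ⊛ prod h (applyUpTo f N)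
prod-applyUpTo-suc h f zero    = λ _ → refl
prod-applyUpTo-suc h f (suc N) k = begin
  (h (f 0) ⊛ prod h (applyUpTo (f ∘ suc) (suc N))) k
    ≡⟨ ⊛-congˡ (h (f 0)) (prod-applyUpTo-suc h (f ∘ suc) N) k ⟩
  (h (f 0) ⊛ (h (f (suc N)) ⊛ rest)) k
    ≡⟨ x∙yz≈y∙xz (h (f 0)) (h (f (suc N))) rest k ⟩
  (h (f (suc N)) ⊛ (h (f 0) ⊛ rest)) k ∎
  where
  open ≡-Reasoning
  rest : Series
  rest = prod h (applyUpTo (f ∘ suc) N)
  open CommSemigroupProperties (CommutativeMonoid.commutativeSemigroup ⊛-commutativeMonoid) using (x∙yz≈y∙xz)

prod-inverse : ∀ {g h} l → (∀ i → g i ⊛ h i ≗ 𝟙) → prod g l ⊛ prod h l ≗ 𝟙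
prod-inverse         []      _      = ⊛-identityˡ 𝟙
prod-inverse {g} {h} (i ∷ l) gh≗𝟙 k = begin
  ((g i ⊛ prod g l) ⊛ (h i ⊛ prod h l)) k ≡⟨ interchange (g i) (prod g l) (h i) (prod h l) k ⟩
  ((g i ⊛ h i) ⊛ (prod g l ⊛ prod h l)) k ≡⟨ ⊛-cong (gh≗𝟙 i) (prod-inverse {g} {h} l gh≗𝟙) k ⟩
  (𝟙 ⊛ 𝟙) k                              ≡⟨ ⊛-identityˡ 𝟙 k ⟩
  𝟙 k                                    ∎
  where
  open ≡-Reasoning
  open CommSemigroupProperties (CommutativeMonoid.commutativeSemigroup ⊛-commutativeMonoid) using (interchange)

^ˢ-coeff-zero : ∀ {X} → X 0 ≡ + 1 → ∀ j → (X ^ˢ j) 0 ≡ + 1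
^ˢ-coeff-zero X₀≡1 zero    = refl
^ˢ-coeff-zero X₀≡1 (suc j) = cong₂ _*_ X₀≡1 (^ˢ-coeff-zero X₀≡1 j)

-- Definitionally, oneMinusX^ k i is indicator 0 i - indicator k i.
oneMinusX^-⊛ : ∀ k f n →
  (oneMinusX^ k ⊛ f) n ≡ sumTo n (λ i → indicator 0 i * f (n ℕ.∸ i)) - sumTo n (λ i → indicator k i * f (n ℕ.∸ i))
oneMinusX^-⊛ k f n =
  trans (sumTo-cong n (λ {i} _ → *-distribʳ-- (indicator 0 i) (indicator k i) (f (n ℕ.∸ i)))) (sumTo-- n _ _)
  where
  *-distribʳ-- : ∀ a b c → (a - b) * c ≡ a * c - b * c
  *-distribʳ-- = solve-∀

oneMinusX^-⊛-< : ∀ k f {n} → n ℕ.< k → (oneMinusX^ k ⊛ f) n ≡ f n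
oneMinusX^-⊛-< k f {n} n<k = trans (oneMinusX^-⊛ k f n)
  (trans (cong₂ _-_ (sumTo-indicator-≤ n {0} g z≤n) (sumTo-indicator-> n {k} g n<k)) (ℤP.+-identityʳ (f n)))
  where
  g : ℕ → ℤ
  g i = f (n ℕ.∸ i)

oneMinusX^-⊛-≥ : ∀ k f {n} → k ℕ.≤ n → (oneMinusX^ k ⊛ f) n ≡ f n - f (n ℕ.∸ k)
oneMinusX^-⊛-≥ k f {n} k≤n =
  trans (oneMinusX^-⊛ k f n) (cong₂ _-_ (sumTo-indicator-≤ n {0} g z≤n) (sumTo-indicator-≤ n {k} g k≤n))
  where
  g : ℕ → ℤ
  g i = f (n ℕ.∸ i)

invOneMinusX^-∣ : ∀ {k n} → k ℕD.∣ n → invOneMinusX^ k n ≡ + 1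
invOneMinusX^-∣ {k} {n} k∣n with k ℕD.∣? n
... | yes _   = refl
... | no k∤n = contradiction k∣n k∤n

invOneMinusX^-∤ : ∀ {k n} → ¬ k ℕD.∣ n → invOneMinusX^ k n ≡ + 0
invOneMinusX^-∤ {k} {n} k∤n with k ℕD.∣? n
... | yes k∣n = contradiction k∣n k∤n
... | no _    = refl

invOneMinusX^-periodic : ∀ {k n} → k ℕ.≤ n → invOneMinusX^ k n ≡ invOneMinusX^ k (n ℕ.∸ k)
invOneMinusX^-periodic {k} {n} k≤n with k ℕD.∣? n
... | yes k∣n = sym (invOneMinusX^-∣ (ℕD.∣m+n∣m⇒∣n (subst (k ℕD.∣_) (sym (ℕP.m+[n∸m]≡n k≤n)) k∣n) ℕD.∣-refl))
... | no k∤n = sym (invOneMinusX^-∤ (λ k∣n∸k → k∤n (ℕD.∣m∸n∣n⇒∣m k k≤n k∣n∸k ℕD.∣-refl)))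

oneMinusX^-inverse : ∀ {k} → 0 ℕ.< k → oneMinusX^ k ⊛ invOneMinusX^ k ≗ 𝟙
oneMinusX^-inverse {k} 0<k zero = trans (oneMinusX^-⊛-< k (invOneMinusX^ k) 0<k) (invOneMinusX^-∣ (k ℕD.∣0))
oneMinusX^-inverse {k@(suc _)} 0<k (suc n) with suc n ℕ.<? k
... | yes n<k = trans (oneMinusX^-⊛-< k (invOneMinusX^ k) n<k) (invOneMinusX^-∤ (λ k∣n → ℕP.<⇒≱ n<k (ℕD.∣⇒≤ k∣n)))
... | no n≮k = trans (oneMinusX^-⊛-≥ k (invOneMinusX^ k) k≤n)
  (trans (cong (_-_ (invOneMinusX^ k (suc n))) (sym (invOneMinusX^-periodic k≤n))) (ℤP.+-inverseʳ (invOneMinusX^ k (suc n))))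
  where
  k≤n : k ℕ.≤ suc n
  k≤n = ℕP.≮⇒≥ n≮k

-- Thue–Morse partial products

TM : ℕ → Series
TM N = prod (λ i → oneMinusX^ (2 ℕ.^ i)) (upTo N)

TM-suc : ∀ N → TM (suc N) ≗ oneMinusX^ (2 ℕ.^ N) ⊛ TM N
TM-suc = prod-applyUpTo-suc (λ i → oneMinusX^ (2 ℕ.^ i)) id

TM-< : ∀ N {n} → n ℕ.< 2 ℕ.^ N → TM (suc N) n ≡ TM N n
TM-< N {n} lt = trans (TM-suc N n) (oneMinusX^-⊛-< (2 ℕ.^ N) (TM N) lt)

TM-≥ : ∀ N {n} → 2 ℕ.^ N ℕ.≤ n → TM (suc N) n ≡ TM N n - TM N (n ℕ.∸ 2 ℕ.^ N)
TM-≥ N {n} le = trans (TM-suc N n) (oneMinusX^-⊛-≥ (2 ℕ.^ N) (TM N) le)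

2^suc : ∀ N → 2 ℕ.^ suc N ≡ 2 ℕ.^ N ℕ.+ 2 ℕ.^ N
2^suc N = cong (2 ℕ.^ N ℕ.+_) (ℕP.+-identityʳ (2 ℕ.^ N))

TM-vanishes : ∀ N {n} → 2 ℕ.^ N ℕ.≤ n → TM N n ≡ + 0
TM-vanishes zero    {suc n} _  = refl
TM-vanishes (suc N) {n}     le = trans (TM-≥ N le₁) (cong₂ _-_ (TM-vanishes N le₁) (TM-vanishes N le₂))
  where
  le₂ : 2 ℕ.^ N ℕ.≤ n ℕ.∸ 2 ℕ.^ N
  le₂ = subst (ℕ._≤ n ℕ.∸ 2 ℕ.^ N) (ℕP.m+n∸m≡n (2 ℕ.^ N) (2 ℕ.^ N))
          (ℕP.∸-monoˡ-≤ (2 ℕ.^ N) (subst (ℕ._≤ n) (2^suc N) le))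
  le₁ : 2 ℕ.^ N ℕ.≤ n
  le₁ = ℕP.≤-trans le₂ (ℕP.m∸n≤m n (2 ℕ.^ N))

TM-shift : ∀ N {r} → r ℕ.< 2 ℕ.^ N → TM (suc N) (r ℕ.+ 2 ℕ.^ N) ≡ - TM N r
TM-shift N {r} _ = begin
  TM (suc N) (r ℕ.+ 2 ℕ.^ N)                          ≡⟨ TM-≥ N (ℕP.m≤n+m (2 ℕ.^ N) r) ⟩
  TM N (r ℕ.+ 2 ℕ.^ N) - TM N (r ℕ.+ 2 ℕ.^ N ℕ.∸ 2 ℕ.^ N) ≡⟨ cong₂ _-_ (TM-vanishes N (ℕP.m≤n+m (2 ℕ.^ N) r))
                                                                  (cong (TM N) (ℕP.m+n∸n≡m r (2 ℕ.^ N))) ⟩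
  + 0 - TM N r                                        ≡⟨ ℤP.+-identityˡ (- TM N r) ⟩
  - TM N r                                            ∎
  where open ≡-Reasoning

split-<2^suc : ∀ N {n} → n ℕ.< 2 ℕ.^ suc N → n ℕ.< 2 ℕ.^ N ⊎ ∃ λ r → r ℕ.< 2 ℕ.^ N × n ≡ r ℕ.+ 2 ℕ.^ N
split-<2^suc N {n} lt with n ℕ.<? 2 ℕ.^ N
... | yes n<2^N = inj₁ n<2^N
... | no n≮2^N = inj₂ (n ℕ.∸ 2 ℕ.^ N , r< , sym (ℕP.m∸n+n≡m 2^N≤n))
  where
  2^N≤n : 2 ℕ.^ N ℕ.≤ n
  2^N≤n = ℕP.≮⇒≥ n≮2^N
  r< : n ℕ.∸ 2 ℕ.^ N ℕ.< 2 ℕ.^ N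
  r< = ℕP.+-cancelʳ-< _ _ (2 ℕ.^ N)
         (subst₂ ℕ._<_ (sym (ℕP.m∸n+n≡m 2^N≤n)) (2^suc N) lt)

TM-zero : ∀ N → TM N 0 ≡ + 1
TM-zero zero    = refl
TM-zero (suc N) = trans (TM-< N (ℕP.m^n>0 2 N)) (TM-zero N)

Sign : ℤ → Set
Sign a = a ≡ + 1 ⊎ a ≡ -[1+ 0 ]

Sign-neg : ∀ {a} → Sign a → Sign (- a)
Sign-neg (inj₁ refl) = inj₂ refl
Sign-neg (inj₂ refl) = inj₁ refl

TM-sign : ∀ N {n} → n ℕ.< 2 ℕ.^ N → Sign (TM N n)
TM-sign zero    {zero} _ = inj₁ refl
TM-sign zero    {suc n} (s≤s ())
TM-sign (suc N) {n}    lt with split-<2^suc N lt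
... | inj₁ n<2^N          = subst Sign (sym (TM-< N n<2^N)) (TM-sign N n<2^N)
... | inj₂ (r , r< , refl) = subst Sign (sym (TM-shift N r<)) (Sign-neg (TM-sign N r<))

half-< : ∀ {j m} → j ℕ.+ j ℕ.< m ℕ.+ m → j ℕ.< m
half-< {j} {m} lt with j ℕ.<? m
... | yes j<m = j<m
... | no j≮m = contradiction (ℕP.+-mono-≤ (ℕP.≮⇒≥ j≮m) (ℕP.≮⇒≥ j≮m)) (ℕP.<⇒≱ lt)

double-< : ∀ {j m} → j ℕ.< m → suc (j ℕ.+ j) ℕ.< m ℕ.+ m
double-< {j} {m} j<m = subst (λ x → suc x ℕ.≤ m ℕ.+ m) (ℕP.+-suc j j) (ℕP.+-mono-≤ j<m j<m)

-- Below 2^M both sides are unchanged by going from depth M to M + 1; on the upper half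
-- [2^M, 2^(M+1)) both change sign (TM-shift).
TM-double : ∀ M {j} → j ℕ.< 2 ℕ.^ M →
  TM (suc M) (j ℕ.+ j) ≡ TM M j × TM (suc M) (suc (j ℕ.+ j)) ≡ - TM M j
TM-double zero    {zero}  _ = TM-< 0 (s≤s z≤n) , TM-shift 0 (s≤s z≤n)
TM-double zero    {suc j} (s≤s ())
TM-double (suc M) {j} lt with split-<2^suc M lt
... | inj₁ j< = trans (TM-< (suc M) (ℕP.<-trans (ℕP.n<1+n _) 2j+1<)) (trans (proj₁ (TM-double M j<)) (sym (TM-< M j<))) ,
                trans (TM-< (suc M) 2j+1<) (trans (proj₂ (TM-double M j<)) (cong -_ (sym (TM-< M j<))))
  where
  2j+1< : suc (j ℕ.+ j) ℕ.< 2 ℕ.^ suc M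
  2j+1< = subst (suc (j ℕ.+ j) ℕ.<_) (sym (2^suc M)) (double-< j<)
... | inj₂ (r , r< , refl) =
  trans (cong (TM (suc (suc M))) (regroup r)) (trans (TM-shift (suc M) 2r<)
    (trans (cong -_ (proj₁ (TM-double M r<))) (sym (TM-shift M r<)))) ,
  trans (cong (TM (suc (suc M)) ∘ suc) (regroup r)) (trans (TM-shift (suc M) 2r+1<)
    (trans (cong -_ (proj₂ (TM-double M r<))) (cong -_ (sym (TM-shift M r<)))))
  where
  m : ℕ
  m = 2 ℕ.^ M
  regroup : ∀ r → (r ℕ.+ m) ℕ.+ (r ℕ.+ m) ≡ (r ℕ.+ r) ℕ.+ 2 ℕ.^ suc M
  regroup r = trans (rearrange r m) (cong ((r ℕ.+ r) ℕ.+_) (sym (2^suc M)))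
    where
    rearrange : ∀ r m → (r ℕ.+ m) ℕ.+ (r ℕ.+ m) ≡ (r ℕ.+ r) ℕ.+ (m ℕ.+ m)
    rearrange = ℕSolver.solve-∀
  2r+1< : suc (r ℕ.+ r) ℕ.< 2 ℕ.^ suc M
  2r+1< = subst (suc (r ℕ.+ r) ℕ.<_) (sym (2^suc M)) (double-< r<)
  2r< : r ℕ.+ r ℕ.< 2 ℕ.^ suc M
  2r< = ℕP.<-trans (ℕP.n<1+n _) 2r+1<

TM-even : ∀ N {j} → j ℕ.+ j ℕ.< 2 ℕ.^ N → TM N (j ℕ.+ j) ≡ TM N j
TM-even zero    {zero}  _         = refl
TM-even zero    {suc j} (s≤s ())
TM-even (suc M) {j}     lt        = trans (proj₁ (TM-double M j<)) (sym (TM-< M j<))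
  where
  j< : j ℕ.< 2 ℕ.^ M
  j< = half-< {j} {2 ℕ.^ M} (subst (j ℕ.+ j ℕ.<_) (2^suc M) lt)

TM-odd : ∀ N {j} → suc (j ℕ.+ j) ℕ.< 2 ℕ.^ N → TM N (suc (j ℕ.+ j)) ≡ - TM N j
TM-odd zero    (s≤s ())
TM-odd (suc M) {j} lt = trans (proj₂ (TM-double M j<)) (cong -_ (sym (TM-< M j<)))
  where
  j< : j ℕ.< 2 ℕ.^ M
  j< = half-< {j} {2 ℕ.^ M} (ℕP.<-trans (ℕP.n<1+n _) (subst (suc (j ℕ.+ j) ℕ.<_) (2^suc M) lt))

n<2^n : ∀ n → n ℕ.< 2 ℕ.^ n
n<2^n zero    = s≤s z≤n
n<2^n (suc n) = subst (suc (suc n) ℕ.≤_) (sym (2^suc n)) (ℕP.+-mono-≤ (ℕP.m^n>0 2 n) (n<2^n n))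

-- Congruences and 2-adic valuations

∣ˢ-sumTo : ∀ n {d} {f : ℕ → ℤ} → (∀ {k} → k ℕ.≤ n → d ∣ˢ f k) → d ∣ˢ sumTo n f
∣ˢ-sumTo zero    d∣f = d∣f z≤n
∣ˢ-sumTo (suc n) d∣f = Signed.∣m∣n⇒∣m+n (∣ˢ-sumTo n (d∣f ∘ ℕP.m≤n⇒m≤1+n)) (d∣f ℕP.≤-refl)

*-pres-∣ˢ : ∀ {a b x y} → a ∣ˢ x → b ∣ˢ y → a * b ∣ˢ x * y
*-pres-∣ˢ {a} {b} (divides p refl) (divides q refl) = divides (p * q) (regroup p a q b)
  where
  regroup : ∀ p a q b → p * a * (q * b) ≡ p * q * (a * b)
  regroup = solve-∀

2^_ : ℕ → ℤ
2^ k = + (2 ℕ.^ k)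

2^-+ : ∀ j k → 2^ (j ℕ.+ k) ≡ 2^ j * 2^ k
2^-+ j k = trans (cong +_ (ℕP.^-distribˡ-+-* 2 j k)) (ℤP.pos-* (2 ℕ.^ j) (2 ℕ.^ k))

2^-suc : ∀ k → 2^ suc k ≡ + 2 * 2^ k
2^-suc = 2^-+ 1

2^-∣ : ∀ {j k} → j ℕ.≤ k → 2^ j ∣ˢ 2^ k
2^-∣ {j} {k} j≤k = divides (2^ (k ℕ.∸ j))
  (trans (cong 2^_ (trans (sym (ℕP.m+[n∸m]≡n j≤k)) (ℕP.+-comm j (k ℕ.∸ j)))) (2^-+ (k ℕ.∸ j) j))

2^-∣-* : ∀ {i j k} → i ℕ.≤ j ℕ.+ k → 2^ i ∣ˢ 2^ j * 2^ k
2^-∣-* {j = j} {k} le = subst (_ ∣ˢ_) (2^-+ j k) (2^-∣ le)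

infix 4 _≡_[mod_]
record _≡_[mod_] (a b d : ℤ) : Set where
  constructor mod-intro
  field ∣-diff : d ∣ˢ a - b
open _≡_[mod_] public

∣ˢ⇒≡0 : ∀ {d a} → d ∣ˢ a → a ≡ + 0 [mod d ]
∣ˢ⇒≡0 {a = a} d∣a = mod-intro (subst (_ ∣ˢ_) (sym (ℤP.+-identityʳ a)) d∣a)

≡-mod-reflexive : ∀ {a b d} → a ≡ b → a ≡ b [mod d ]
≡-mod-reflexive {a} refl = mod-intro (subst (_ ∣ˢ_) (sym (ℤP.+-inverseʳ a)) (divides (+ 0) refl))

≡-mod-sym : ∀ {a b d} → a ≡ b [mod d ] → b ≡ a [mod d ]
≡-mod-sym {a} {b} (mod-intro d∣a-b) = mod-intro (subst (_ ∣ˢ_) (negate a b) (Signed.∣m⇒∣-m d∣a-b))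
  where
  negate : ∀ a b → - (a - b) ≡ b - a
  negate = solve-∀

≡-mod-trans : ∀ {a b c d} → a ≡ b [mod d ] → b ≡ c [mod d ] → a ≡ c [mod d ]
≡-mod-trans {a} {b} {c} (mod-intro d∣a-b) (mod-intro d∣b-c) =
  mod-intro (subst (_ ∣ˢ_) (telescope a b c) (Signed.∣m∣n⇒∣m+n d∣a-b d∣b-c))
  where
  telescope : ∀ a b c → (a - b) + (b - c) ≡ a - c
  telescope = solve-∀

≡-mod-setoid : ℤ → Setoid 0ℓ 0ℓ
≡-mod-setoid d = record
  { Carrier = ℤ
  ; _≈_ = λ a b → a ≡ b [mod d ]
  ; isEquivalence = record { refl = ≡-mod-reflexive refl ; sym = ≡-mod-sym ; trans = ≡-mod-trans } }

≡-mod-+ : ∀ {a b c e d} → a ≡ b [mod d ] → c ≡ e [mod d ] → a + c ≡ b + e [mod d ]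
≡-mod-+ {a} {b} {c} {e} (mod-intro d∣a-b) (mod-intro d∣c-e) =
  mod-intro (subst (_ ∣ˢ_) (regroup a b c e) (Signed.∣m∣n⇒∣m+n d∣a-b d∣c-e))
  where
  regroup : ∀ a b c e → (a - b) + (c - e) ≡ a + c - (b + e)
  regroup = solve-∀

≡-mod-weaken : ∀ {a b d e} → e ∣ˢ d → a ≡ b [mod d ] → a ≡ b [mod e ]
≡-mod-weaken e∣d (mod-intro d∣a-b) = mod-intro (Signed.∣-trans e∣d d∣a-b)

-- a has 2-adic valuation exactly K precisely when a ≡ 2^K (mod 2^(K+1)).
valuation-∣ : ∀ {a K} → a ≡ 2^ K [mod 2^ suc K ] → 2^ K ∣ˢ a
valuation-∣ {a} {K} (mod-intro d∣a-2^K) = subst (_ ∣ˢ_) (cancel a (2^ K))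
  (Signed.∣m∣n⇒∣m+n (Signed.∣-trans (2^-∣ (ℕP.n≤1+n K)) d∣a-2^K) (Signed.∣-refl {2^ K}))
  where
  cancel : ∀ a b → (a - b) + b ≡ a
  cancel = solve-∀

exact⇒ν₂≡ : ∀ {a K} → a ≡ 2^ K [mod 2^ suc K ] → ν₂≡ a K
exact⇒ν₂≡ {a} {K} a≡2^K = Signed.∣⇒∣ᵤ (valuation-∣ {K = K} a≡2^K) , λ 2^K+1∣a →
  ℕP.<⇒≱ (ℕP.^-monoʳ-< 2 (s≤s (s≤s z≤n)) (ℕP.n<1+n K))
    (ℕD.∣⇒≤ {{ℕP.m^n≢0 2 K}} (Signed.∣⇒∣ᵤ (2^K+1∣2^K (Signed.∣ᵤ⇒∣ 2^K+1∣a))))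
  where
  2^K+1∣2^K : 2^ suc K ∣ˢ a → 2^ suc K ∣ˢ 2^ K
  2^K+1∣2^K d∣a = subst (_ ∣ˢ_) (cancel a (2^ K)) (Signed.∣m∣n⇒∣m-n d∣a (∣-diff a≡2^K))
    where
    cancel : ∀ a b → a - (a - b) ≡ b
    cancel = solve-∀

*-exact : ∀ {c z j K} → c ≡ 2^ j [mod 2^ suc j ] → z ≡ 2^ K [mod 2^ suc K ] →
          c * z ≡ 2^ (j ℕ.+ K) [mod 2^ suc (j ℕ.+ K) ]
*-exact {c} {z} {j} {K} c≡2^j z≡2^K =
  mod-intro (subst (_ ∣ˢ_) (split c z) (Signed.∣m∣n⇒∣m+n 2^j+K+1∣c[z-2^K] 2^j+K+1∣[c-2^j]2^K))
  where
  split : ∀ c z → c * (z - 2^ K) + (c - 2^ j) * 2^ K ≡ c * z - 2^ (j ℕ.+ K)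
  split c z = trans (distribute c z (2^ j) (2^ K)) (cong (λ p → c * z - p) (sym (2^-+ j K)))
    where
    distribute : ∀ c z a b → c * (z - b) + (c - a) * b ≡ c * z - a * b
    distribute = solve-∀
  2^j+K+1∣c[z-2^K] : 2^ suc (j ℕ.+ K) ∣ˢ c * (z - 2^ K)
  2^j+K+1∣c[z-2^K] = subst (_∣ˢ c * (z - 2^ K)) (trans (sym (2^-+ j (suc K))) (cong 2^_ (ℕP.+-suc j K)))
    (*-pres-∣ˢ (valuation-∣ {K = j} c≡2^j) (∣-diff z≡2^K))
  2^j+K+1∣[c-2^j]2^K : 2^ suc (j ℕ.+ K) ∣ˢ (c - 2^ j) * 2^ K
  2^j+K+1∣[c-2^j]2^K = subst (_∣ˢ (c - 2^ j) * 2^ K) (sym (2^-+ (suc j) K))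
    (*-pres-∣ˢ (∣-diff c≡2^j) (Signed.∣-refl {2^ K}))

Sign-diff-even : ∀ {a b} → Sign a → Sign b → a - b ≡ + 0 [mod + 2 ]
Sign-diff-even (inj₁ refl) (inj₁ refl) = mod-intro (divides (+ 0) refl)
Sign-diff-even (inj₁ refl) (inj₂ refl) = mod-intro (divides (+ 1) refl)
Sign-diff-even (inj₂ refl) (inj₁ refl) = mod-intro (divides -[1+ 0 ] refl)
Sign-diff-even (inj₂ refl) (inj₂ refl) = mod-intro (divides (+ 0) refl)

Sign-diff-≢ : ∀ {a b} → Sign a → Sign b → a ≢ b → a - b ≡ + 2 [mod + 4 ]
Sign-diff-≢ (inj₁ refl) (inj₁ refl) a≢b = contradiction refl a≢b
Sign-diff-≢ (inj₁ refl) (inj₂ refl) _   = mod-intro (divides (+ 0) refl)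
Sign-diff-≢ (inj₂ refl) (inj₁ refl) _   = mod-intro (divides -[1+ 0 ] refl)
Sign-diff-≢ (inj₂ refl) (inj₂ refl) a≢b = contradiction refl a≢b

Sign-quadruple : ∀ {a} → Sign a → (- a - a) + (- a - a) ≡ + 4 [mod + 8 ]
Sign-quadruple (inj₁ refl) = mod-intro (divides -[1+ 0 ] refl)
Sign-quadruple (inj₂ refl) = mod-intro (divides (+ 0) refl)

Sign-even-square : ∀ {a b} → Sign a → Sign b → (a - - b) + (a - - b) + (a - b) * (a - b) ≡ + 4 [mod + 8 ]
Sign-even-square (inj₁ refl) (inj₁ refl) = mod-intro (divides (+ 0) refl)
Sign-even-square (inj₁ refl) (inj₂ refl) = mod-intro (divides (+ 0) refl)
Sign-even-square (inj₂ refl) (inj₁ refl) = mod-intro (divides (+ 0) refl)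
Sign-even-square (inj₂ refl) (inj₂ refl) = mod-intro (divides -[1+ 0 ] refl)

parity : ∀ n → ∃ λ j → n ≡ j ℕ.+ j ⊎ n ≡ suc (j ℕ.+ j)
parity zero    = 0 , inj₁ refl
parity (suc n) with parity n
... | j , inj₁ refl = j , inj₂ refl
... | j , inj₂ refl = suc j , inj₁ (cong suc (sym (ℕP.+-suc j j)))

odd-cofactor : ∀ {A k} → 2 ℕ.^ k ℕD.∣ A → ¬ 2 ℕ.^ suc k ℕD.∣ A → ∃ λ b → A ≡ suc (b ℕ.+ b) ℕ.* 2 ℕ.^ k
odd-cofactor {A} {k} (ℕD.divides q A≡q*2^k) 2^k+1∤A with parity q
... | b , inj₁ refl = contradiction (ℕD.divides b (trans A≡q*2^k (regroup b (2 ℕ.^ k)))) 2^k+1∤A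
  where
  regroup : ∀ b x → (b ℕ.+ b) ℕ.* x ≡ b ℕ.* (2 ℕ.* x)
  regroup = ℕSolver.solve-∀
... | b , inj₂ refl = b , A≡q*2^k

∣-neg : ∀ {d a} → d ∣ a → d ∣ - a
∣-neg {d} {a} d∣a = Signed.∣⇒∣ᵤ {d} { - a} (Signed.∣m⇒∣-m (Signed.∣ᵤ⇒∣ {d} {a} d∣a))

ν₂≡-neg : ∀ {a k} → ν₂≡ a k → ν₂≡ (- a) k
ν₂≡-neg {a} (2^k∣a , 2^k+1∤a) = subst (_ ℕD.∣_) (sym (ℤP.∣-i∣≡∣i∣ a)) 2^k∣a , 2^k+1∤a ∘ subst (_ ℕD.∣_) (ℤP.∣-i∣≡∣i∣ a)

odd⇒suc-even : ∀ {m} → ¬ (+ 2) ∣ m → (+ 2) ∣ m + + 1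
odd⇒suc-even {m} 2∤m with m ℤ.% + 2 | ℤDivMod.n%d<d m (+ 2) | ℤDivMod.a≡a%n+[a/n]*n m (+ 2)
... | zero        | _            | m≡ = contradiction (Signed.∣⇒∣ᵤ (divides (m ℤ./ + 2) (trans m≡ (ℤP.+-identityˡ _)))) 2∤m
... | suc zero    | _            | m≡ = Signed.∣⇒∣ᵤ (divides (m ℤ./ + 2 + + 1) (trans (cong (_+ + 1) m≡) (regroup (m ℤ./ + 2))))
  where
  regroup : ∀ q → + 1 + q * + 2 + + 1 ≡ (q + + 1) * + 2
  regroup = solve-∀
... | suc (suc _) | s≤s (s≤s ()) | _

-- Cauchy squares and powers close to 1

⊛-peel : ∀ f g n →
  (f ⊛ g) (suc (suc n)) ≡ f 0 * g (suc (suc n)) + (((f ∘ suc) ⊛ (g ∘ suc)) n + f (suc (suc n)) * g 0)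
⊛-peel f g n = trans (sumTo-suc (suc n) _) (cong (_+_ (f 0 * g (suc (suc n)))) (cong₂ _+_
  (sumTo-cong n (λ {k} k≤n → cong (λ i → f (suc k) * g i) (ℕP.+-∸-assoc 1 k≤n)))
  (cong (λ i → f (suc (suc n)) * g i) (ℕP.n∸n≡0 n))))

twice-product : ∀ {d a b} → d ∣ˢ a → d ∣ˢ b → a * b + b * a ≡ + 0 [mod + 2 * (d * d) ]
twice-product {d} {a} {b} d∣a d∣b =
  mod-intro (subst (_ ∣ˢ_) (double a b) (Signed.*-monoʳ-∣ (+ 2) (*-pres-∣ˢ d∣a d∣b)))
  where
  double : ∀ a b → + 2 * (a * b) ≡ a * b + b * a - + 0
  double = solve-∀

-- The outer terms F 0 · F (n+2) and F (n+2) · F 0 are equal and each divisible by d².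
⊛-square-peel : ∀ F n {d} → d ∣ˢ F 0 → d ∣ˢ F (suc (suc n)) →
  (F ⊛ F) (suc (suc n)) ≡ ((F ∘ suc) ⊛ (F ∘ suc)) n [mod + 2 * (d * d) ]
⊛-square-peel F n {d} d∣F₀ d∣Fₙ = begin
  (F ⊛ F) (suc (suc n))        ≡⟨ ⊛-peel F F n ⟩
  a * b + (s + b * a)          ≡⟨ regroup a b s ⟩
  s + (a * b + b * a)          ≈⟨ ≡-mod-+ (≡-mod-reflexive {s} refl) (twice-product d∣F₀ d∣Fₙ) ⟩
  s + + 0                      ≡⟨ ℤP.+-identityʳ s ⟩
  s                            ∎
  where
  open import Relation.Binary.Reasoning.Setoid (≡-mod-setoid (+ 2 * (d * d)))
  a b s : ℤ
  a = F 0
  b = F (suc (suc n))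
  s = ((F ∘ suc) ⊛ (F ∘ suc)) n
  regroup : ∀ a b s → a * b + (s + b * a) ≡ s + (a * b + b * a)
  regroup = solve-∀

⊛-square-even : ∀ j F {d} → (∀ {a} → a ℕ.≤ j ℕ.+ j → d ∣ˢ F a) →
  (F ⊛ F) (j ℕ.+ j) ≡ F j * F j [mod + 2 * (d * d) ]
⊛-square-even zero    F d∣F = ≡-mod-reflexive refl
⊛-square-even (suc j) F {d} d∣F = begin
  (F ⊛ F) (suc j ℕ.+ suc j)             ≡⟨ cong (F ⊛ F) (cong suc (ℕP.+-suc j j)) ⟩
  (F ⊛ F) (suc (suc (j ℕ.+ j)))         ≈⟨ ⊛-square-peel F (j ℕ.+ j) (d∣F z≤n) (d∣F (ℕP.≤-reflexive (sym m≡))) ⟩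
  ((F ∘ suc) ⊛ (F ∘ suc)) (j ℕ.+ j)     ≈⟨ ⊛-square-even j (F ∘ suc) (λ a≤ → d∣F (ℕP.≤-trans (s≤s a≤) 1+2j≤)) ⟩
  F (suc j) * F (suc j)                 ∎
  where
  open import Relation.Binary.Reasoning.Setoid (≡-mod-setoid (+ 2 * (d * d)))
  m≡ : suc j ℕ.+ suc j ≡ suc (suc (j ℕ.+ j))
  m≡ = cong suc (ℕP.+-suc j j)
  1+2j≤ : suc (j ℕ.+ j) ℕ.≤ suc j ℕ.+ suc j
  1+2j≤ = ℕP.≤-trans (ℕP.n≤1+n _) (ℕP.≤-reflexive (sym m≡))

⊛-square-odd : ∀ j F {d} → (∀ {a} → a ℕ.≤ suc (j ℕ.+ j) → d ∣ˢ F a) →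
  (F ⊛ F) (suc (j ℕ.+ j)) ≡ + 0 [mod + 2 * (d * d) ]
⊛-square-odd zero    F d∣F = twice-product (d∣F z≤n) (d∣F ℕP.≤-refl)
⊛-square-odd (suc j) F {d} d∣F = begin
  (F ⊛ F) (suc (suc j ℕ.+ suc j))       ≡⟨ cong (F ⊛ F) m≡ ⟩
  (F ⊛ F) (suc (suc (suc (j ℕ.+ j))))   ≈⟨ ⊛-square-peel F (suc (j ℕ.+ j)) (d∣F z≤n) (d∣F (ℕP.≤-reflexive (sym m≡))) ⟩
  ((F ∘ suc) ⊛ (F ∘ suc)) (suc (j ℕ.+ j)) ≈⟨ ⊛-square-odd j (F ∘ suc) (λ a≤ → d∣F (ℕP.≤-trans (s≤s a≤) 2+2j≤)) ⟩
  + 0                                   ∎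
  where
  open import Relation.Binary.Reasoning.Setoid (≡-mod-setoid (+ 2 * (d * d)))
  m≡ : suc (suc j ℕ.+ suc j) ≡ suc (suc (suc (j ℕ.+ j)))
  m≡ = cong (suc ∘ suc) (ℕP.+-suc j j)
  2+2j≤ : suc (suc (j ℕ.+ j)) ℕ.≤ suc (suc j ℕ.+ suc j)
  2+2j≤ = ℕP.≤-trans (ℕP.n≤1+n _) (ℕP.≤-reflexive (sym m≡))

-- Coefficientwise congruences at the indices below B.  The coefficient of index n of f ⊛ g
-- involves only coefficients of index ≤ n, which makes them compatible with ⊛.
module Below (B : ℕ) where

  infix 4 _≈_[mod_]
  record _≈_[mod_] (f g : Series) (d : ℤ) : Set where
    constructor coeffwise
    field at : ∀ {n} → n ℕ.< B → f n ≡ g n [mod d ]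
  open _≈_[mod_] public

  ≈-reflexive : ∀ {f g d} → f ≗ g → f ≈ g [mod d ]
  ≈-reflexive f≗g = coeffwise λ {n} _ → ≡-mod-reflexive (f≗g n)

  ≈-sym : ∀ {f g d} → f ≈ g [mod d ] → g ≈ f [mod d ]
  ≈-sym f≈g = coeffwise (≡-mod-sym ∘ at f≈g)

  ≈-trans : ∀ {f g h d} → f ≈ g [mod d ] → g ≈ h [mod d ] → f ≈ h [mod d ]
  ≈-trans f≈g g≈h = coeffwise λ lt → ≡-mod-trans (at f≈g lt) (at g≈h lt)

  ≈-setoid : ℤ → Setoid 0ℓ 0ℓ
  ≈-setoid d = record
    { Carrier = Series
    ; _≈_ = λ f g → f ≈ g [mod d ]
    ; isEquivalence = record { refl = ≈-reflexive (λ _ → refl) ; sym = ≈-sym ; trans = ≈-trans } }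

  ≈-weaken : ∀ {f g d e} → e ∣ˢ d → f ≈ g [mod d ] → f ≈ g [mod e ]
  ≈-weaken e∣d f≈g = coeffwise (≡-mod-weaken e∣d ∘ at f≈g)

  ⊛-≈ˡ : ∀ {f f′ d} g → f ≈ f′ [mod d ] → f ⊛ g ≈ f′ ⊛ g [mod d ]
  ⊛-≈ˡ {f} {f′} g f≈f′ = coeffwise λ {n} n<B → mod-intro (subst (_ ∣ˢ_) (⊛-distribʳ-- f f′ g n)
    (∣ˢ-sumTo n λ k≤n → Signed.∣m⇒∣m*n _ (∣-diff (at f≈f′ (ℕP.≤-<-trans k≤n n<B)))))

  ⊛-≈-expand : ∀ {X Y d e} → X ≈ 𝟙 [mod d ] → Y ≈ 𝟙 [mod e ] → X ⊛ Y ≈ X +ˢ Y -ˢ 𝟙 [mod d * e ]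
  ⊛-≈-expand {X} {Y} X≈𝟙 Y≈𝟙 = coeffwise λ {n} n<B → mod-intro (subst (_ ∣ˢ_) (sym (remainder n))
    (∣ˢ-sumTo n λ {k} k≤n → *-pres-∣ˢ (∣-diff (at X≈𝟙 (ℕP.≤-<-trans k≤n n<B)))
                                      (∣-diff (at Y≈𝟙 (ℕP.≤-<-trans (ℕP.m∸n≤m n k) n<B)))))
    where
    remainder : ∀ n → (X ⊛ Y) n - (X +ˢ Y -ˢ 𝟙) n ≡ ((X -ˢ 𝟙) ⊛ (Y -ˢ 𝟙)) n
    remainder n = trans (cong (_- (X +ˢ Y -ˢ 𝟙) n) (⊛-expand X Y n))
                        (cancel ((X +ˢ Y -ˢ 𝟙) n) (((X -ˢ 𝟙) ⊛ (Y -ˢ 𝟙)) n))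
      where
      cancel : ∀ a r → a + r - a ≡ r
      cancel = solve-∀

  ^ˢ-≈𝟙 : ∀ {X d} → X ≈ 𝟙 [mod d ] → ∀ n → X ^ˢ n ≈ 𝟙 [mod d ]
  ^ˢ-≈𝟙 X≈𝟙 zero    = ≈-reflexive (λ _ → refl)
  ^ˢ-≈𝟙 {X} {d} X≈𝟙 (suc n) = begin
    X ⊛ X ^ˢ n ≈⟨ ⊛-≈ˡ (X ^ˢ n) X≈𝟙 ⟩
    𝟙 ⊛ X ^ˢ n ≈⟨ ≈-reflexive (⊛-identityˡ (X ^ˢ n)) ⟩
    X ^ˢ n     ≈⟨ ^ˢ-≈𝟙 X≈𝟙 n ⟩
    𝟙          ∎
    where open import Relation.Binary.Reasoning.Setoid (≈-setoid d)

  ^ˢ-binomial : ∀ {X d} → X ≈ 𝟙 [mod d ] → ∀ a → X ^ˢ a ≈ 𝟙 +ˢ + a ·ˢ (X -ˢ 𝟙) [mod d * d ]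
  ^ˢ-binomial {X} X≈𝟙 zero = ≈-reflexive λ n → vanish (𝟙 n) (X n)
    where
    vanish : ∀ o x → o ≡ o + + 0 * (x - o)
    vanish = solve-∀
  ^ˢ-binomial {X} {d} X≈𝟙 (suc a) = begin
    X ⊛ X ^ˢ a
      ≈⟨ ⊛-≈-expand X≈𝟙 (^ˢ-≈𝟙 X≈𝟙 a) ⟩
    X +ˢ X ^ˢ a -ˢ 𝟙
      ≈⟨ coeffwise (λ {n} lt → ≡-mod-+ (≡-mod-+ (≡-mod-reflexive {X n} refl) (at IH lt)) (≡-mod-reflexive { - 𝟙 n} refl)) ⟩
    X +ˢ (𝟙 +ˢ + a ·ˢ (X -ˢ 𝟙)) -ˢ 𝟙
      ≈⟨ ≈-reflexive (λ n → trans (collect (X n) (𝟙 n) (+ a)) (cong (λ c → 𝟙 n + c * (X n - 𝟙 n)) (sym (ℤP.pos-+ 1 a)))) ⟩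
    𝟙 +ˢ + suc a ·ˢ (X -ˢ 𝟙) ∎
    where
    open import Relation.Binary.Reasoning.Setoid (≈-setoid (d * d))
    IH : X ^ˢ a ≈ 𝟙 +ˢ + a ·ˢ (X -ˢ 𝟙) [mod d * d ]
    IH = ^ˢ-binomial X≈𝟙 a
    collect : ∀ x o a → x + (o + a * (x - o)) - o ≡ o + (+ 1 + a) * (x - o)
    collect = solve-∀

  ⊛-inverse-≈𝟙 : ∀ {X Y d} → X ⊛ Y ≗ 𝟙 → X ≈ 𝟙 [mod d ] → Y ≈ 𝟙 [mod d ]
  ⊛-inverse-≈𝟙 {X} {Y} {d} XY≗𝟙 X≈𝟙 = begin
    Y      ≈⟨ ≈-reflexive (λ n → sym (⊛-identityˡ Y n)) ⟩
    𝟙 ⊛ Y  ≈⟨ ⊛-≈ˡ Y (≈-sym X≈𝟙) ⟩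
    X ⊛ Y  ≈⟨ ≈-reflexive XY≗𝟙 ⟩
    𝟙      ∎
    where open import Relation.Binary.Reasoning.Setoid (≈-setoid d)

  ⊛-inverse-≈ : ∀ {X Y d} → X ⊛ Y ≗ 𝟙 → X ≈ 𝟙 [mod d ] → Y ≈ 𝟙 +ˢ -[1+ 0 ] ·ˢ (X -ˢ 𝟙) [mod d * d ]
  ⊛-inverse-≈ {X} {Y} {d} XY≗𝟙 X≈𝟙 = begin
    Y
      ≈⟨ ≈-reflexive (λ n → split (X n) (Y n) (𝟙 n)) ⟩
    (X +ˢ Y -ˢ 𝟙) +ˢ (𝟙 -ˢ X)
      ≈⟨ coeffwise (λ {n} lt → ≡-mod-+ (at (≈-sym XY≈) lt) (≡-mod-reflexive {𝟙 n - X n} refl)) ⟩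
    X ⊛ Y +ˢ (𝟙 -ˢ X)
      ≈⟨ ≈-reflexive (λ n → trans (cong (_+ (𝟙 n - X n)) (XY≗𝟙 n)) (negate (𝟙 n) (X n))) ⟩
    𝟙 +ˢ -[1+ 0 ] ·ˢ (X -ˢ 𝟙) ∎
    where
    open import Relation.Binary.Reasoning.Setoid (≈-setoid (d * d))
    XY≈ : X ⊛ Y ≈ X +ˢ Y -ˢ 𝟙 [mod d * d ]
    XY≈ = ⊛-≈-expand X≈𝟙 (⊛-inverse-≈𝟙 {X} {Y} XY≗𝟙 X≈𝟙)
    split : ∀ x y o → y ≡ (x + y - o) + (o - x)
    split = solve-∀
    negate : ∀ o x → o + (o - x) ≡ o + -[1+ 0 ] * (x - o)
    negate = solve-∀

  record NearOne (K : ℕ) (X : Series) : Set where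
    field
      ≈𝟙    : X ≈ 𝟙 [mod 2^ K ]
      exact : ∀ {n} → suc n ℕ.< B → X (suc n) ≡ 2^ K [mod 2^ suc K ]
  open NearOne public

  nearOne-intro : ∀ {K X} → X 0 ≡ + 1 → (∀ {n} → suc n ℕ.< B → X (suc n) ≡ 2^ K [mod 2^ suc K ]) → NearOne K X
  nearOne-intro {K} X₀≡1 exact-at = record
    { ≈𝟙    = coeffwise λ
        { {zero}  _  → ≡-mod-reflexive X₀≡1
        ; {suc n} lt → ∣ˢ⇒≡0 (valuation-∣ {K = K} (exact-at lt))
        }
    ; exact = exact-at
    }

  nearOne-≗ : ∀ {K X Y} → X ≗ Y → NearOne K X → NearOne K Y
  nearOne-≗ X≗Y X-near = record
    { ≈𝟙 = ≈-trans (≈-reflexive (λ n → sym (X≗Y n))) (≈𝟙 X-near)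
    ; exact = λ {n} lt → ≡-mod-trans (≡-mod-reflexive (sym (X≗Y (suc n)))) (exact X-near lt) }

  nearOne-affine : ∀ {K j c Z X} → NearOne K Z → c ≡ 2^ j [mod 2^ suc j ] →
                   X ≈ 𝟙 +ˢ c ·ˢ (Z -ˢ 𝟙) [mod 2^ suc (j ℕ.+ K) ] → NearOne (j ℕ.+ K) X
  nearOne-affine {K} {j} {c} {Z} Z-near c≡2^j X≈ = record
    { ≈𝟙    = ≈-trans (≈-weaken (2^-∣ (ℕP.n≤1+n (j ℕ.+ K))) X≈) affine≈𝟙
    ; exact = λ {n} lt → ≡-mod-trans (at X≈ lt) (≡-mod-trans (≡-mod-reflexive (drop-𝟙 c (Z (suc n))))
                                                     (*-exact {j = j} {K = K} c≡2^j (exact Z-near lt)))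
    }
    where
    cancel : ∀ o r → o + r - o ≡ r
    cancel = solve-∀
    drop-𝟙 : ∀ c z → + 0 + c * (z - + 0) ≡ c * z
    drop-𝟙 = solve-∀
    affine≈𝟙 : 𝟙 +ˢ c ·ˢ (Z -ˢ 𝟙) ≈ 𝟙 [mod 2^ (j ℕ.+ K) ]
    affine≈𝟙 = coeffwise λ {n} lt → mod-intro (subst₂ _∣ˢ_ (sym (2^-+ j K)) (sym (cancel (𝟙 n) (c * (Z n - 𝟙 n))))
      (*-pres-∣ˢ (valuation-∣ {K = j} c≡2^j) (∣-diff (at (≈𝟙 Z-near) lt))))

  nearOne-^ˢ-odd : ∀ {K X} → 1 ℕ.≤ K → NearOne K X → ∀ b → NearOne K (X ^ˢ suc (b ℕ.+ b))
  nearOne-^ˢ-odd {K} 1≤K X-near b = nearOne-affine {j = 0} X-near odd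
    (≈-weaken (2^-∣-* {suc K} {K} {K} (ℕP.+-monoˡ-≤ K 1≤K)) (^ˢ-binomial (≈𝟙 X-near) (suc (b ℕ.+ b))))
    where
    twice : ∀ b → b ℕ.+ b ≡ b ℕ.* 2
    twice = ℕSolver.solve-∀
    odd : + suc (b ℕ.+ b) ≡ 2^ 0 [mod 2^ 1 ]
    odd = mod-intro (divides (+ b) (trans (cong +_ (twice b)) (ℤP.pos-* b 2)))

  nearOne-square : ∀ {K X} → 2 ℕ.≤ K → NearOne K X → NearOne (suc K) (X ^ˢ 2)
  nearOne-square {K} 2≤K X-near = nearOne-affine {j = 1} X-near (≡-mod-reflexive refl)
    (≈-weaken (2^-∣-* {suc (suc K)} {K} {K} (ℕP.+-monoˡ-≤ K 2≤K))
              (^ˢ-binomial (≈𝟙 X-near) 2))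

  nearOne-inverse : ∀ {K X Y} → 1 ℕ.≤ K → X ⊛ Y ≗ 𝟙 → NearOne K X → NearOne K Y
  nearOne-inverse {K} 1≤K XY≗𝟙 X-near = nearOne-affine {j = 0} X-near (mod-intro (divides -[1+ 0 ] refl))
    (≈-weaken (2^-∣-* {suc K} {K} {K} (ℕP.+-monoˡ-≤ K 1≤K))
              (⊛-inverse-≈ XY≗𝟙 (≈𝟙 X-near)))

  nearOne-^ˢ-2^ : ∀ {X} → NearOne 2 (X ^ˢ 2) → ∀ k → NearOne (suc (suc k)) (X ^ˢ (2 ℕ.^ suc k))
  nearOne-^ˢ-2^     X²-near zero    = X²-near
  nearOne-^ˢ-2^ {X} X²-near (suc k) =
    nearOne-≗ (^ˢ-assoc X (2 ℕ.^ suc k) 2) (nearOne-square (s≤s (s≤s z≤n)) (nearOne-^ˢ-2^ X²-near k))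

  nearOne-^ˢ : ∀ {X} → NearOne 2 (X ^ˢ 2) → ∀ k b → NearOne (suc (suc k)) (X ^ˢ (suc (b ℕ.+ b) ℕ.* 2 ℕ.^ suc k))
  nearOne-^ˢ {X} X²-near k b =
    nearOne-≗ (^ˢ-assoc X (2 ℕ.^ suc k) (suc (b ℕ.+ b))) (nearOne-^ˢ-odd (s≤s z≤n) (nearOne-^ˢ-2^ X²-near k) b)

-- The partial products of depth N, examined at the indices below 2^N: there TM N has the
-- coefficients ±1 of the Thue–Morse sequence, and U = (1 - x) · TM N those of tₙ - tₙ₋₁.
module Truncated (N : ℕ) where
  open Below (2 ℕ.^ N)

  U V : Series
  U = oneMinusX^ 1 ⊛ TM N
  V = invOneMinusX^ 1 ⊛ prod (λ i → invOneMinusX^ (2 ℕ.^ i)) (upTo N)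

  -- As 2^0 = 1, U and V are the products of the factors indexed by 0 ∷ upTo N.
  U⊛V≗𝟙 : U ⊛ V ≗ 𝟙
  U⊛V≗𝟙 = prod-inverse {λ i → oneMinusX^ (2 ℕ.^ i)} {λ i → invOneMinusX^ (2 ℕ.^ i)} (0 ∷ upTo N)
    (λ i → oneMinusX^-inverse (ℕP.m^n>0 2 i))

  U-zero : U 0 ≡ + 1
  U-zero = trans (oneMinusX^-⊛-< 1 (TM N) (s≤s z≤n)) (TM-zero N)

  U-suc : ∀ n → U (suc n) ≡ TM N (suc n) - TM N n
  U-suc n = oneMinusX^-⊛-≥ 1 (TM N) (s≤s z≤n)

  V-zero : V 0 ≡ + 1
  V-zero = trans (sym (ℤP.*-identityˡ (V 0))) (trans (cong (_* V 0) (sym U-zero)) (U⊛V≗𝟙 0))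

  U-≈𝟙 : U ≈ 𝟙 [mod + 2 ]
  U-≈𝟙 = coeffwise λ
    { {zero}  _  → ≡-mod-reflexive U-zero
    ; {suc n} lt → ≡-mod-trans (≡-mod-reflexive (U-suc n))
                     (Sign-diff-even (TM-sign N lt) (TM-sign N (ℕP.<-trans (ℕP.n<1+n n) lt)))
    }

  H : Series
  H = U -ˢ 𝟙

  H-even : ∀ {a} → a ℕ.< 2 ℕ.^ N → + 2 ∣ˢ H a
  H-even lt = ∣-diff (at U-≈𝟙 lt)

  U²-suc : ∀ n → (U ^ˢ 2) (suc n) ≡ U (suc n) + U (suc n) + (H ⊛ H) (suc n)
  U²-suc n = trans (⊛-congˡ U (⊛-identityʳ U) (suc n))
    (trans (⊛-expand U U (suc n)) (cong (_+ (H ⊛ H) (suc n)) (ℤP.+-identityʳ (U (suc n) + U (suc n)))))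

  U²-odd : ∀ j → suc (j ℕ.+ j) ℕ.< 2 ℕ.^ N → (U ^ˢ 2) (suc (j ℕ.+ j)) ≡ + 4 [mod + 8 ]
  U²-odd j lt = begin
    (U ^ˢ 2) (suc (j ℕ.+ j))        ≡⟨ U²-suc (j ℕ.+ j) ⟩
    u + u + (H ⊛ H) (suc (j ℕ.+ j)) ≈⟨ ≡-mod-+ (≡-mod-reflexive {u + u} refl) H²≡0 ⟩
    u + u + + 0                     ≡⟨ ℤP.+-identityʳ (u + u) ⟩
    u + u                           ≡⟨ cong (λ u → u + u) U-odd ⟩
    (- a - a) + (- a - a)           ≈⟨ Sign-quadruple (TM-sign N j<) ⟩
    + 4                             ∎
    where
    open import Relation.Binary.Reasoning.Setoid (≡-mod-setoid (+ 8))
    u a : ℤ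
    u = U (suc (j ℕ.+ j))
    a = TM N j
    2j< : j ℕ.+ j ℕ.< 2 ℕ.^ N
    2j< = ℕP.<-trans (ℕP.n<1+n _) lt
    j< : j ℕ.< 2 ℕ.^ N
    j< = ℕP.≤-<-trans (ℕP.m≤m+n j j) 2j<
    U-odd : u ≡ - a - a
    U-odd = trans (U-suc (j ℕ.+ j)) (cong₂ _-_ (TM-odd N lt) (TM-even N 2j<))
    H²≡0 : (H ⊛ H) (suc (j ℕ.+ j)) ≡ + 0 [mod + 8 ]
    H²≡0 = ⊛-square-odd j H (λ a≤ → H-even (ℕP.≤-<-trans a≤ lt))

  U²-even : ∀ i → suc i ℕ.+ suc i ℕ.< 2 ℕ.^ N → (U ^ˢ 2) (suc i ℕ.+ suc i) ≡ + 4 [mod + 8 ]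
  U²-even i lt = begin
    (U ^ˢ 2) (suc i ℕ.+ suc i)                  ≡⟨ U²-suc (i ℕ.+ suc i) ⟩
    u + u + (H ⊛ H) (suc i ℕ.+ suc i)           ≈⟨ ≡-mod-+ (≡-mod-reflexive {u + u} refl) H²≡Hᵢ² ⟩
    u + u + H (suc i) * H (suc i)               ≡⟨ cong₂ (λ u h → u + u + h * h) U-even (ℤP.+-identityʳ (U (suc i))) ⟩
    (a - - b) + (a - - b) + U (suc i) * U (suc i) ≡⟨ cong (λ h → (a - - b) + (a - - b) + h * h) (U-suc i) ⟩
    (a - - b) + (a - - b) + (a - b) * (a - b)   ≈⟨ Sign-even-square (TM-sign N i+1<) (TM-sign N i<) ⟩
    + 4                                         ∎
    where
    open import Relation.Binary.Reasoning.Setoid (≡-mod-setoid (+ 8))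
    u a b : ℤ
    u = U (suc i ℕ.+ suc i)
    a = TM N (suc i)
    b = TM N i
    2i+1≡ : i ℕ.+ suc i ≡ suc (i ℕ.+ i)
    2i+1≡ = ℕP.+-suc i i
    2i+1< : suc (i ℕ.+ i) ℕ.< 2 ℕ.^ N
    2i+1< = subst (ℕ._< 2 ℕ.^ N) 2i+1≡ (ℕP.<-trans (ℕP.n<1+n _) lt)
    i+1< : suc i ℕ.< 2 ℕ.^ N
    i+1< = ℕP.≤-<-trans (ℕP.m≤m+n (suc i) (suc i)) lt
    i< : i ℕ.< 2 ℕ.^ N
    i< = ℕP.<-trans (ℕP.n<1+n i) i+1<
    U-even : u ≡ a - - b
    U-even = trans (U-suc (i ℕ.+ suc i)) (cong₂ _-_ (TM-even N lt) (trans (cong (TM N) 2i+1≡) (TM-odd N 2i+1<)))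
    H²≡Hᵢ² : (H ⊛ H) (suc i ℕ.+ suc i) ≡ H (suc i) * H (suc i) [mod + 8 ]
    H²≡Hᵢ² = ⊛-square-even (suc i) H (λ a≤ → H-even (ℕP.≤-<-trans a≤ lt))

  nearOne-U² : NearOne 2 (U ^ˢ 2)
  nearOne-U² = nearOne-intro (^ˢ-coeff-zero {U} U-zero 2) exact-U²
    where
    below : ℕ → Set
    below m = m ℕ.< 2 ℕ.^ N
    exact-U² : ∀ {n} → suc n ℕ.< 2 ℕ.^ N → (U ^ˢ 2) (suc n) ≡ + 4 [mod + 8 ]
    exact-U² {n} lt with parity (suc n)
    ... | zero  , inj₁ ()
    ... | suc i , inj₁ e = subst (λ m → (U ^ˢ 2) m ≡ + 4 [mod + 8 ]) (sym e) (U²-even i (subst below e lt))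
    ... | j     , inj₂ e = subst (λ m → (U ^ˢ 2) m ≡ + 4 [mod + 8 ]) (sym e) (U²-odd j (subst below e lt))


  nearOne-V² : NearOne 2 (V ^ˢ 2)
  nearOne-V² = nearOne-inverse (s≤s z≤n) (⊛-inverse-^ˢ {U} {V} 2 U⊛V≗𝟙) nearOne-U²

  powℤ : ℤ → Series
  powℤ (+ j)    = U ^ˢ j
  powℤ -[1+ j ] = V ^ˢ suc j

  powℤ-zero : ∀ e → powℤ e 0 ≡ + 1
  powℤ-zero (+ j)    = ^ˢ-coeff-zero {U} U-zero j
  powℤ-zero -[1+ j ] = ^ˢ-coeff-zero {V} V-zero (suc j)

  powℤ-1+ : ∀ e → powℤ (+ 1 + e) ≗ U ⊛ powℤ e
  powℤ-1+ (+ j)          _ = refl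
  powℤ-1+ -[1+ zero ]    n = sym (trans (⊛-congˡ U (⊛-identityʳ V) n) (U⊛V≗𝟙 n))
  powℤ-1+ -[1+ suc j ]   n = sym (begin
    (U ⊛ (V ⊛ V ^ˢ suc j)) n ≡⟨ ⊛-assoc U V (V ^ˢ suc j) n ⟨
    ((U ⊛ V) ⊛ V ^ˢ suc j) n ≡⟨ ⊛-congʳ (V ^ˢ suc j) U⊛V≗𝟙 n ⟩
    (𝟙 ⊛ V ^ˢ suc j) n       ≡⟨ ⊛-identityˡ (V ^ˢ suc j) n ⟩
    (V ^ˢ suc j) n           ∎)
    where open ≡-Reasoning

  powℤ-even-≈𝟙 : ∀ {e} → (+ 2) ∣ e → powℤ e ≈ 𝟙 [mod + 4 ]
  powℤ-even-≈𝟙 {+ j} (ℕD.divides q j≡q*2) = subst (λ i → U ^ˢ i ≈ 𝟙 [mod + 4 ]) (sym j≡q*2)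
    (≈-trans (≈-reflexive (λ n → sym (^ˢ-assoc U 2 q n))) (^ˢ-≈𝟙 (≈𝟙 nearOne-U²) q))
  powℤ-even-≈𝟙 { -[1+ j ]} (ℕD.divides q j+1≡q*2) = subst (λ i → V ^ˢ i ≈ 𝟙 [mod + 4 ]) (sym j+1≡q*2)
    (≈-trans (≈-reflexive (λ n → sym (^ˢ-assoc V 2 q n))) (^ˢ-≈𝟙 (≈𝟙 nearOne-V²) q))

  nearOne-powℤ : ∀ {e k} → ν₂≡ e (suc k) → NearOne (suc (suc k)) (powℤ e)
  nearOne-powℤ {+ zero} (_ , 2^k+2∤0) = contradiction (_ ℕD.∣0) 2^k+2∤0
  nearOne-powℤ {+ suc j} {k} (2^k+1∣e , 2^k+2∤e) with odd-cofactor {suc j} {suc k} 2^k+1∣e 2^k+2∤e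
  ... | b , e≡ = subst (λ i → NearOne (suc (suc k)) (U ^ˢ i)) (sym e≡) (nearOne-^ˢ nearOne-U² k b)
  nearOne-powℤ { -[1+ j ]} {k} (2^k+1∣e , 2^k+2∤e) with odd-cofactor {suc j} {suc k} 2^k+1∣e 2^k+2∤e
  ... | b , e≡ = subst (λ i → NearOne (suc (suc k)) (V ^ˢ i)) (sym e≡) (nearOne-^ˢ nearOne-V² k b)

  U⊛-coeff : ∀ {W d n} → W ≈ 𝟙 [mod d ] → suc n ℕ.< 2 ℕ.^ N → (U ⊛ W) (suc n) ≡ U (suc n) + W (suc n) [mod + 2 * d ]
  U⊛-coeff {W} {n = n} W≈𝟙 lt =
    ≡-mod-trans (at (⊛-≈-expand U-≈𝟙 W≈𝟙) lt) (≡-mod-reflexive (ℤP.+-identityʳ (U (suc n) + W (suc n))))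

  ν₂-U⊛-jump : ∀ {W n} → W ≈ 𝟙 [mod + 4 ] → suc n ℕ.< 2 ℕ.^ N → TM N (suc n) ≢ TM N n → ν₂≡ ((U ⊛ W) (suc n)) 1
  ν₂-U⊛-jump {W} {n} W≈𝟙 lt jump = exact⇒ν₂≡ {K = 1} (begin
    (U ⊛ W) (suc n)        ≈⟨ ≡-mod-weaken (divides (+ 2) refl) (U⊛-coeff W≈𝟙 lt) ⟩
    U (suc n) + W (suc n)  ≈⟨ ≡-mod-+ U≡2 (at W≈𝟙 lt) ⟩
    + 2                    ∎)
    where
    open import Relation.Binary.Reasoning.Setoid (≡-mod-setoid (+ 4))
    U≡2 : U (suc n) ≡ + 2 [mod + 4 ]
    U≡2 = ≡-mod-trans (≡-mod-reflexive (U-suc n))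
            (Sign-diff-≢ (TM-sign N lt) (TM-sign N (ℕP.<-trans (ℕP.n<1+n n) lt)) jump)

  ν₂-U⊛-flat : ∀ {K W n} → NearOne K W → suc n ℕ.< 2 ℕ.^ N → TM N (suc n) ≡ TM N n → ν₂≡ ((U ⊛ W) (suc n)) K
  ν₂-U⊛-flat {K} {W} {n} W-near lt flat = exact⇒ν₂≡ {K = K} (begin
    (U ⊛ W) (suc n)        ≈⟨ ≡-mod-weaken (Signed.∣-reflexive (2^-suc K)) (U⊛-coeff (≈𝟙 W-near) lt) ⟩
    U (suc n) + W (suc n)  ≡⟨ cong (_+ W (suc n)) U≡0 ⟩
    + 0 + W (suc n)        ≡⟨ ℤP.+-identityˡ (W (suc n)) ⟩
    W (suc n)              ≈⟨ exact W-near lt ⟩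
    2^ K                   ∎)
    where
    open import Relation.Binary.Reasoning.Setoid (≡-mod-setoid (2^ suc K))
    U≡0 : U (suc n) ≡ + 0
    U≡0 = trans (U-suc n) (trans (cong (_- TM N n) flat) (ℤP.+-inverseʳ (TM N n)))

  ν₂-coeff-even : ∀ {m n} → suc n ℕ.< 2 ℕ.^ N → (+ 2) ∣ m → ∀ k → ν₂≡ m k → ν₂≡ (powℤ (- m) (suc n)) (suc k)
  ν₂-coeff-even lt 2∣m zero    (_ , 2∤m) = contradiction 2∣m 2∤m
  ν₂-coeff-even {m} lt 2∣m (suc k) ν₂m =
    exact⇒ν₂≡ {K = suc (suc k)} (exact (nearOne-powℤ { - m} {k} (ν₂≡-neg {m} {suc k} ν₂m)) lt)

  powℤ-neg≗U⊛ : ∀ m → powℤ (- m) ≗ U ⊛ powℤ (- (m + + 1))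
  powℤ-neg≗U⊛ m n = trans (cong (λ e → powℤ e n) (split m)) (powℤ-1+ (- (m + + 1)) n)
    where
    split : ∀ m → - m ≡ + 1 + - (m + + 1)
    split = solve-∀

  ν₂-coeff-jump : ∀ {m n} → suc n ℕ.< 2 ℕ.^ N → ¬ (+ 2) ∣ m → TM N (suc n) ≢ TM N n → ν₂≡ (powℤ (- m) (suc n)) 1
  ν₂-coeff-jump {m} {n} lt 2∤m jump = subst (λ c → ν₂≡ c 1) (sym (powℤ-neg≗U⊛ m (suc n)))
    (ν₂-U⊛-jump (powℤ-even-≈𝟙 { - (m + + 1)} (∣-neg {+ 2} {m + + 1} (odd⇒suc-even {m} 2∤m))) lt jump)

  ν₂-coeff-flat : ∀ {m n} → suc n ℕ.< 2 ℕ.^ N → ¬ (+ 2) ∣ m → TM N (suc n) ≡ TM N n →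
                  ∀ k → ν₂≡ (m + + 1) k → ν₂≡ (powℤ (- m) (suc n)) (suc k)
  ν₂-coeff-flat {m} lt 2∤m flat zero    (_ , 2∤m+1) = contradiction (odd⇒suc-even {m} 2∤m) 2∤m+1
  ν₂-coeff-flat {m} {n} lt 2∤m flat (suc k) ν₂m+1 = subst (λ c → ν₂≡ c (suc (suc k))) (sym (powℤ-neg≗U⊛ m (suc n)))
    (ν₂-U⊛-flat (nearOne-powℤ { - (m + + 1)} {k} (ν₂≡-neg {m + + 1} {suc k} ν₂m+1)) lt flat)

  partialProd-≗-powℤ : ∀ e → oneMinusX^-pow 1 e ⊛ partialProd e N ≗ powℤ e
  partialProd-≗-powℤ (+ j) n = trans
    (⊛-congˡ (oneMinusX^ 1 ^ˢ j) (prod-^ˢ (λ i → oneMinusX^ (2 ℕ.^ i)) j (upTo N)) n)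
    (sym (^ˢ-distrib-⊛ (oneMinusX^ 1) (TM N) j n))
  partialProd-≗-powℤ -[1+ j ] n = trans
    (⊛-congˡ (invOneMinusX^ 1 ^ˢ suc j) (prod-^ˢ (λ i → invOneMinusX^ (2 ℕ.^ i)) (suc j) (upTo N)) n)
    (sym (^ˢ-distrib-⊛ (invOneMinusX^ 1) (prod (λ i → invOneMinusX^ (2 ℕ.^ i)) (upTo N)) (suc j) n))

  partialProd-≗-TM : oneMinusX^-pow 1 (+ 0) ⊛ partialProd (+ 1) N ≗ TM N
  partialProd-≗-TM n = trans (⊛-identityˡ (partialProd (+ 1) N) n)
    (prod-cong (upTo N) (λ i → ⊛-identityʳ (oneMinusX^ (2 ℕ.^ i))) n)

deep-truncation : ∀ m c t → IsCoeffsOf (- m) (- m) c → IsCoeffsOf (+ 0) (+ 1) t → ∀ n → ∃ λ N →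
  suc n ℕ.< 2 ℕ.^ N × c (suc n) ≡ Truncated.powℤ N (- m) (suc n) × t (suc n) ≡ TM N (suc n) × t n ≡ TM N n
deep-truncation m c t hc ht n = N , ℕP.≤-<-trans n+1≤N (n<2^n N) ,
  trans (sym (proj₂ (hc (suc n)) N c≤N)) (Truncated.partialProd-≗-powℤ N (- m) (suc n)) ,
  trans (sym (proj₂ (ht (suc n)) N t₁≤N)) (Truncated.partialProd-≗-TM N (suc n)) ,
  trans (sym (proj₂ (ht n) N t₀≤N)) (Truncated.partialProd-≗-TM N n)
  where
  c₁ t₁ t₀ N : ℕ
  c₁ = proj₁ (hc (suc n))
  t₁ = proj₁ (ht (suc n))
  t₀ = proj₁ (ht n)
  N = c₁ ℕ.⊔ (t₁ ℕ.⊔ (t₀ ℕ.⊔ suc n))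
  c≤N : c₁ ℕ.≤ N
  c≤N = ℕP.m≤m⊔n c₁ _
  t₁≤N : t₁ ℕ.≤ N
  t₁≤N = ℕP.≤-trans (ℕP.m≤m⊔n t₁ _) (ℕP.m≤n⊔m c₁ _)
  t₀≤N : t₀ ℕ.≤ N
  t₀≤N = ℕP.≤-trans (ℕP.m≤m⊔n t₀ (suc n)) (ℕP.≤-trans (ℕP.m≤n⊔m t₁ _) (ℕP.m≤n⊔m c₁ _))
  n+1≤N : suc n ℕ.≤ N
  n+1≤N = ℕP.≤-trans (ℕP.m≤n⊔m t₀ (suc n)) (ℕP.≤-trans (ℕP.m≤n⊔m t₁ _) (ℕP.m≤n⊔m c₁ _))

theorem2p4 : (m : ℤ) → m ≢ + 0 → m ≢ -[1+ 0 ] →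
    (c t : Series) →
    IsCoeffsOf (- m) (- m) c →
    IsCoeffsOf (+ 0) (+ 1) t →
    (c 0 ≡ + 1) ×
    (∀ (n : ℕ) →
      ((+ 2) ∣ m → ∀ k → ν₂≡ m k → ν₂≡ (c (suc n)) (suc k)) ×
      (¬ ((+ 2) ∣ m) → t (suc n) ≢ t n → ν₂≡ (c (suc n)) 1) ×
      (¬ ((+ 2) ∣ m) → t (suc n) ≡ t n →
        ∀ k → ν₂≡ (m + + 1) k → ν₂≡ (c (suc n)) (suc k)))
theorem2p4 m _ _ c t hc ht = c₀≡1 , coefficient
  where
  c₀≡1 : c 0 ≡ + 1
  c₀≡1 = trans (sym (proj₂ (hc 0) N₀ ℕP.≤-refl))
    (trans (Truncated.partialProd-≗-powℤ N₀ (- m) 0) (Truncated.powℤ-zero N₀ (- m)))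
    where
    N₀ : ℕ
    N₀ = proj₁ (hc 0)
  coefficient : ∀ n →
    ((+ 2) ∣ m → ∀ k → ν₂≡ m k → ν₂≡ (c (suc n)) (suc k)) ×
    (¬ ((+ 2) ∣ m) → t (suc n) ≢ t n → ν₂≡ (c (suc n)) 1) ×
    (¬ ((+ 2) ∣ m) → t (suc n) ≡ t n → ∀ k → ν₂≡ (m + + 1) k → ν₂≡ (c (suc n)) (suc k))
  coefficient n with deep-truncation m c t hc ht n
  ... | N , lt , c≡ , t₁≡ , t₀≡ =
    (λ 2∣m k ν₂m → subst (λ x → ν₂≡ x (suc k)) (sym c≡) (ν₂-coeff-even {m} lt 2∣m k ν₂m)) ,
    (λ 2∤m t≢ → subst (λ x → ν₂≡ x 1) (sym c≡)
                  (ν₂-coeff-jump {m} lt 2∤m (λ TM≡ → t≢ (trans t₁≡ (trans TM≡ (sym t₀≡)))))) ,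
    (λ 2∤m t≡ k ν₂ → subst (λ x → ν₂≡ x (suc k)) (sym c≡)
                       (ν₂-coeff-flat {m} lt 2∤m (trans (sym t₁≡) (trans t≡ t₀≡)) k ν₂))
    where open Truncated N
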